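{- Let $G$ be a finite graph (loops and parallel edges allowed), let $w\ge 0$ be an integer, and let $(A',B')$ and $(P,Q)$ be separations of $G$ such that $(A',B')$ is $w$-good and $(P,Q)\le (A',B')$. If there are $|P\cap Q|$ pairwise vertex-disjoint paths of $G$ between $P$ and $B'$, then $(P,Q)$ is $w$-good.
   Context: For $X\subseteq V(G)$, $G[X]$ denotes the induced subgraph on $X$. A path-decomposition of a graph $H$ is a sequence $(W_1,\ldots,W_n)$ of subsets of $V(H)$ (bags) with union $V(H)$, such that for every edge $uv$ of $H$ some $W_i$ contains both $u$ and $v$, and $W_i\cap W_k\subseteq W_j$ whenever $1\le i<j<k\le n$; it has width at most $w$ if $|W_i|\le w+1$ for all $i$. A separation of $G$ is a pair $(A,B)$ of subsets of $V(G)$ with $A\cup B=V(G)$ such that no edge of $G$ joins a vertex of $A\setminus B$ to a vertex of $B\setminus A$; its order is $|A\cap B|$. For separations $(A,B),(A',B')$ we write $(A,B)\le(A',B')$ if $A\subseteq A'$ and $B'\subseteq B$. A separation $(A,B)$ is $w$-good if $G[A]$ has a path-decomposition of width at most $w$ whose last bag is $A\cap B$. A path between $P$ and $B'$ is a path with one end in $P$ and the other end in $B'$ (possibly a single vertex in $P\cap B'$). -}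

module Defs where

open import Data.Nat using (ℕ; suc; _≤_)
open import Data.Fin using (Fin; zero; suc; fromℕ; inject₁; _<_)
open import Data.Fin.Subset using (Subset; _∈_; _∉_; _⊆_; _∩_; ∣_∣)
open import Data.Product using (Σ; ∃; _×_; _,_; proj₁; proj₂)
open import Data.Sum using (_⊎_)
open import Relation.Nullary using (¬_)
open import Data.Empty using (⊥)
open import Relation.Binary.PropositionalEquality using (_≡_; _≢_)
open import Function.Definitions using (Injective)

-- A finite multigraph (loops and parallel edges allowed):
-- vertices Fin nV, edges Fin nE, each edge has an (unordered) pair of ends.
record Graph : Set where
  field
    nV   : ℕ
    nE   : ℕ
    ends : Fin nE → Fin nV × Fin nV
open Graph public

V : Graph → Set
V G = Fin (nV G)

VSet : Graph → Set
VSet G = Subset (nV G)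

Adjacent : (G : Graph) → V G → V G → Set
Adjacent G u v = ∃ λ e → (ends G e ≡ (u , v)) ⊎ (ends G e ≡ (v , u))

record IsSeparation (G : Graph) (A B : VSet G) : Set where
  field
    covers : ∀ v → v ∈ A ⊎ v ∈ B
    noEdge : ∀ u v → Adjacent G u v → u ∈ A → u ∉ B → v ∈ B → v ∉ A → ⊥

order : (G : Graph) → VSet G → VSet G → ℕ
order G A B = ∣ A ∩ B ∣

_,_≤Sep_,_ : {G : Graph} → VSet G → VSet G → VSet G → VSet G → Set
A , B ≤Sep A' , B' = A ⊆ A' × B' ⊆ B

record PathDecomposition (G : Graph) (X : VSet G) (w : ℕ) : Set where
  field
    k       : ℕ
    bag     : Fin (suc k) → VSet G
    inX     : ∀ i → bag i ⊆ X
    cover   : ∀ v → v ∈ X → ∃ λ i → v ∈ bag i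
    edgeIn  : ∀ e → proj₁ (ends G e) ∈ X → proj₂ (ends G e) ∈ X →
              ∃ λ i → proj₁ (ends G e) ∈ bag i × proj₂ (ends G e) ∈ bag i
    interp  : ∀ i j l → i < j → j < l → (bag i ∩ bag l) ⊆ bag j
    width   : ∀ i → ∣ bag i ∣ ≤ suc w
  lastBag : VSet G
  lastBag = bag (fromℕ k)

Good : (G : Graph) → ℕ → VSet G → VSet G → Set
Good G w A B = Σ (PathDecomposition G A w) λ D → PathDecomposition.lastBag D ≡ A ∩ B

record Path (G : Graph) : Set where
  field
    len : ℕ
    vtx : Fin (suc len) → V G
    distinct : Injective _≡_ _≡_ vtx
    adj : ∀ (i : Fin len) → Adjacent G (vtx (inject₁ i)) (vtx (suc i))
  start : V G
  start = vtx zero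
  end : V G
  end = vtx (fromℕ len)
open Path public

Between : (G : Graph) → VSet G → VSet G → Path G → Set
Between G S T p = (start p ∈ S × end p ∈ T) ⊎ (end p ∈ S × start p ∈ T)

Disjoint : (G : Graph) {m : ℕ} → (Fin m → Path G) → Set
Disjoint G ps = ∀ i j → i ≢ j → ∀ a b → vtx (ps i) a ≢ vtx (ps j) b

module Submission where

-- Along each of the |P ∩ Q| disjoint paths take the stretch from its last vertex in P to the
-- first vertex of B′ after it. Such a stretch stays inside A′, starts in P ∩ Q and meets P
-- nowhere else, so these stretches are disjoint and their first vertices exhaust P ∩ Q.
-- Contract every stretch onto its first vertex: a bag W of the decomposition of G[A′] becomes
-- (W ∩ P) together with the first vertices of the stretches meeting W. Since a connected set
-- meets an interval of bags, this is a path-decomposition of G[P]; charging each first vertex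
-- to a vertex of its stretch lying in W shows the width does not grow; and as every stretch
-- meets A′ ∩ B′, the old last bag, the new last bag is exactly P ∩ Q.

open import Defs
open import Data.Nat using (ℕ; zero; suc; _≤_)
open import Data.Nat.Properties using (≤-trans; 1+n≰n)
open import Data.Bool using (true; false)
open import Data.Fin using (Fin; zero; suc; fromℕ; inject₁; opposite; _<_; _≟_)
open import Data.Fin.Properties using (injective⇒≤; suc-injective; opposite-involutive; <-cmp; any?)
open import Data.Fin.Subset using (Subset; _∈_; _∉_; _⊆_; _∩_; ∣_∣)
open import Data.Fin.Subset.Properties using (_∈?_; x∈p∩q⁺; x∈p∩q⁻; ⊆-antisym)
open import Data.Vec using (_∷_; here; there)
import Data.Vec as Vec
open import Data.Vec.Properties using (lookup∘tabulate; lookup⇒[]=; []=⇒lookup)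
open import Data.Maybe using (just)
import Data.Maybe.Relation.Unary.Any as Maybe
open import Data.List using (List; []; _∷_; tabulate; last)
open import Data.List.Relation.Unary.Any using (Any; here; there)
import Data.List.Relation.Unary.Any as Any
open import Data.List.Relation.Unary.All using (All; []; _∷_)
import Data.List.Relation.Unary.All as All
open import Data.List.Relation.Unary.All.Properties using (¬Any⇒All¬; anti-mono)
open import Data.List.Relation.Unary.Linked using (Linked; [-]; _∷_)
open import Data.List.Membership.Propositional using (find; lose) renaming (_∈_ to _∈ₗ_)
open import Data.List.Membership.Propositional.Properties using (∈-tabulate⁺; ∈-tabulate⁻)
open import Data.List.Relation.Binary.Subset.Propositional using () renaming (_⊆_ to _⊆ₗ_)
open import Data.List.Relation.Binary.Subset.Propositional.Properties using (∷⁺ʳ)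
open import Data.Product using (Σ; ∃; ∃₂; _×_; _,_; proj₁; proj₂)
open import Data.Sum using (_⊎_; inj₁; inj₂)
open import Data.Empty using (⊥; ⊥-elim)
open import Function using (_∘_; id)
open import Function.Definitions using (Injective)
open import Relation.Nullary using (¬_; yes; no; does)
open import Relation.Nullary.Decidable using (dec-true; _×-dec_; _⊎-dec_)
open import Relation.Unary using (Pred; Decidable)
open import Relation.Binary using (Rel; tri<; tri≈; tri>)
open import Relation.Binary.PropositionalEquality using (_≡_; refl; sym; trans; cong; subst)

module _ {n : ℕ} where

  subsetOf : ∀ {ℓ} {P : Pred (Fin n) ℓ} → Decidable P → Subset n
  subsetOf P? = Vec.tabulate (does ∘ P?)

  module _ {ℓ} {P : Pred (Fin n) ℓ} (P? : Decidable P) {x : Fin n} where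

    ∈-subsetOf⁺ : P x → x ∈ subsetOf P?
    ∈-subsetOf⁺ px = lookup⇒[]= x _ (trans (lookup∘tabulate _ x) (dec-true (P? x) px))

    ∈-subsetOf⁻ : x ∈ subsetOf P? → P x
    ∈-subsetOf⁻ x∈ with P? x | trans (sym (lookup∘tabulate (does ∘ P?) x)) ([]=⇒lookup x∈)
    ... | yes px | _ = px
    ... | no _   | ()

rank : ∀ {n} {p : Subset n} {x} → x ∈ p → Fin ∣ p ∣
rank {p = true ∷ p}  here        = zero
rank {p = true ∷ p}  (there x∈p) = suc (rank x∈p)
rank {p = false ∷ p} (there x∈p) = rank x∈p

rank-injective : ∀ {n} {p : Subset n} {x y} (x∈p : x ∈ p) (y∈p : y ∈ p) → rank x∈p ≡ rank y∈p → x ≡ y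
rank-injective {p = true ∷ p}  here        here        _  = refl
rank-injective {p = true ∷ p}  (there x∈p) (there y∈p) eq = cong suc (rank-injective x∈p y∈p (suc-injective eq))
rank-injective {p = false ∷ p} (there x∈p) (there y∈p) eq = cong suc (rank-injective x∈p y∈p eq)

select : ∀ {n} (p : Subset n) → Fin ∣ p ∣ → Fin n
select (true ∷ p)  zero    = zero
select (true ∷ p)  (suc i) = suc (select p i)
select (false ∷ p) i       = suc (select p i)

select∈ : ∀ {n} (p : Subset n) i → select p i ∈ p
select∈ (true ∷ p)  zero    = here
select∈ (true ∷ p)  (suc i) = there (select∈ p i)
select∈ (false ∷ p) i       = there (select∈ p i)

select-injective : ∀ {n} (p : Subset n) → Injective _≡_ _≡_ (select p)
select-injective (true ∷ p)  {zero}  {zero}  _  = refl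
select-injective (true ∷ p)  {suc i} {suc j} eq = cong suc (select-injective p (suc-injective eq))
select-injective (false ∷ p)                 eq = select-injective p (suc-injective eq)

injection⇒≤∣p∣ : ∀ {m n} {p : Subset n} (h : Fin m → Fin n) → (∀ i → h i ∈ p) → Injective _≡_ _≡_ h →
                 m ≤ ∣ p ∣
injection⇒≤∣p∣ h h∈p h-inj = injective⇒≤ (λ eq → h-inj (rank-injective (h∈p _) (h∈p _) eq))

injection⇒surjective : ∀ {n} {p : Subset n} (h : Fin ∣ p ∣ → Fin n) → (∀ i → h i ∈ p) →
                       Injective _≡_ _≡_ h → ∀ {x} → x ∈ p → ∃ λ i → h i ≡ x
injection⇒surjective {n} {p} h h∈p h-inj {x} x∈p with any? (λ i → h i ≟ x)
... | yes hit = hit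
... | no miss = ⊥-elim (1+n≰n (injection⇒≤∣p∣ h′ h′∈p h′-inj))
  where
  h′ : Fin (suc ∣ p ∣) → Fin n
  h′ zero    = x
  h′ (suc i) = h i
  h′∈p : ∀ i → h′ i ∈ p
  h′∈p zero    = x∈p
  h′∈p (suc i) = h∈p i
  h′-inj : Injective _≡_ _≡_ h′
  h′-inj {zero}  {zero}  _  = refl
  h′-inj {zero}  {suc j} eq = ⊥-elim (miss (j , sym eq))
  h′-inj {suc i} {zero}  eq = ⊥-elim (miss (i , eq))
  h′-inj {suc i} {suc j} eq = cong suc (h-inj eq)

opposite-inject₁ : ∀ {n} (i : Fin n) → opposite (inject₁ i) ≡ suc (opposite i)
opposite-inject₁ zero    = refl
opposite-inject₁ (suc i) = cong inject₁ (opposite-inject₁ i)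

module _ {a} {A : Set a} where

  last-tabulate⁺ : ∀ {p} {P : Pred A p} {n} (f : Fin (suc n) → A) → P (f (fromℕ n)) →
                   Maybe.Any P (last (tabulate f))
  last-tabulate⁺ {n = zero}  f pf = Maybe.just pf
  last-tabulate⁺ {n = suc n} f pf = last-tabulate⁺ (f ∘ suc) pf

  Any-last : ∀ {p} {P : Pred A p} {xs} → Maybe.Any P (last xs) → Any P xs
  Any-last {xs = x ∷ []}     (Maybe.just px) = here px
  Any-last {xs = x ∷ y ∷ ys} p               = there (Any-last {xs = y ∷ ys} p)

  linked-tabulate : ∀ {r} {R : Rel A r} {n} (f : Fin (suc n) → A) →
                    (∀ i → R (f (inject₁ i)) (f (suc i))) → Linked R (tabulate f)
  linked-tabulate {n = zero}  f _ = [-]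
  linked-tabulate {n = suc n} f r = r zero ∷ linked-tabulate (f ∘ suc) (r ∘ suc)

  module _ {r p} {R : Rel A r} {P : Pred A p} (P? : Decidable P) where

    lastOccurrence : ∀ {xs} → Linked R xs → Any P xs →
                     ∃₂ λ x t → P x × All (¬_ ∘ P) t × Linked R (x ∷ t) × last (x ∷ t) ≡ last xs × x ∷ t ⊆ₗ xs
    lastOccurrence [-] (here px) = _ , [] , px , [] , [-] , refl , id
    lastOccurrence {x ∷ y ∷ ys} (r ∷ rs) px∈xs with Any.any? P? (y ∷ ys)
    ... | yes later = let z , t , pz , ¬pt , rt , last≡ , ⊆ys = lastOccurrence rs later
                      in z , t , pz , ¬pt , rt , last≡ , there ∘ ⊆ys
    ... | no none = x , y ∷ ys , P-head px∈xs , ¬Any⇒All¬ _ none , r ∷ rs , refl , id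
      where
      P-head : Any P (x ∷ y ∷ ys) → P x
      P-head (here px)     = px
      P-head (there later) = ⊥-elim (none later)

IsWalk : (G : Graph) → List (V G) → Set
IsWalk G = Linked (Adjacent G)

vertices : {G : Graph} → Path G → List (V G)
vertices p = tabulate (vtx p)

module _ {G : Graph} where

  Adjacent-sym : ∀ {u v} → Adjacent G u v → Adjacent G v u
  Adjacent-sym (e , inj₁ eq) = e , inj₂ eq
  Adjacent-sym (e , inj₂ eq) = e , inj₁ eq

  walkAlong : ∀ {S T : VSet G} (p : Path G) → Between G S T p →
              ∃ λ l → IsWalk G l × Any (_∈ S) l × Maybe.Any (_∈ T) (last l) × l ⊆ₗ vertices p
  walkAlong p (inj₁ (start∈S , end∈T)) =
    vertices p , linked-tabulate (vtx p) (adj p) , here start∈S , last-tabulate⁺ (vtx p) end∈T , id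
  walkAlong {T = T} p (inj₂ (end∈S , start∈T)) =
    tabulate (vtx p ∘ opposite) , linked-tabulate (vtx p ∘ opposite) backwards , here end∈S ,
    last-tabulate⁺ (vtx p ∘ opposite) (subst (λ i → vtx p i ∈ T) (sym (opposite-involutive zero)) start∈T) ,
    on-p
    where
    backwards : ∀ i → Adjacent G (vtx p (opposite (inject₁ i))) (vtx p (opposite (suc i)))
    backwards i rewrite opposite-inject₁ i = Adjacent-sym (adj p (opposite i))
    on-p : tabulate (vtx p ∘ opposite) ⊆ₗ vertices p
    on-p v∈ with i , refl ← ∈-tabulate⁻ {f = vtx p ∘ opposite} v∈ = ∈-tabulate⁺ {f = vtx p} (opposite i)

  neighbour∈A : ∀ {A B : VSet G} {u v} → IsSeparation G A B → Adjacent G u v → u ∈ A → u ∉ B → v ∈ A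
  neighbour∈A {A} {v = v} sep uv u∈A u∉B with v ∈? A | IsSeparation.covers sep v
  ... | yes v∈A | _        = v∈A
  ... | no v∉A  | inj₁ v∈A = ⊥-elim (v∉A v∈A)
  ... | no v∉A  | inj₂ v∈B = ⊥-elim (IsSeparation.noEdge sep _ v uv u∈A u∉B v∈B v∉A)

  initialSegmentWithin : ∀ {A B : VSet G} {x t} → IsSeparation G A B →
                         IsWalk G (x ∷ t) → x ∈ A → Any (_∈ B) (x ∷ t) →
                         ∃ λ s → IsWalk G (x ∷ s) × All (_∈ A) (x ∷ s) × Any (_∈ B) (x ∷ s) × s ⊆ₗ t
  initialSegmentWithin {B = B} {x} sep walk x∈A meetsB with x ∈? B
  ... | yes x∈B = [] , [-] , x∈A ∷ [] , here x∈B , λ ()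
  ... | no x∉B with walk | meetsB
  ...   | _          | here x∈B      = ⊥-elim (x∉B x∈B)
  ...   | xy ∷ walk′ | there meetsB′ =
    let s , walk″ , ⊆A , meetsB″ , s⊆t = initialSegmentWithin sep walk′ (neighbour∈A sep xy x∈A x∉B) meetsB′
    in _ ∷ s , xy ∷ walk″ , x∈A ∷ ⊆A , there meetsB″ , ∷⁺ʳ _ s⊆t

record Crossing (G : Graph) (A B P : VSet G) (l : List (V G)) : Set where
  field
    first   : V G
    rest    : List (V G)
    isWalk  : IsWalk G (first ∷ rest)
    first∈P : first ∈ P
    rest∉P  : All (_∉ P) rest
    within  : All (_∈ A) (first ∷ rest)
    meetsB  : Any (_∈ B) (first ∷ rest)
    sublist : first ∷ rest ⊆ₗ l

module _ {G : Graph} {A B P : VSet G} where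

  crossing : ∀ {l} → IsSeparation G A B → P ⊆ A →
             IsWalk G l → Any (_∈ P) l → Maybe.Any (_∈ B) (last l) → Crossing G A B P l
  crossing sep P⊆A walk meetsP endsInB =
    let x , t , x∈P , t∉P , walk′ , last≡ , ⊆l = lastOccurrence (_∈? P) walk meetsP
        s , walk″ , within , meetsB , s⊆t =
          initialSegmentWithin sep walk′ (P⊆A x∈P) (Any-last (subst (Maybe.Any (_∈ B)) (sym last≡) endsInB))
    in record { first = x ; rest = s ; isWalk = walk″ ; first∈P = x∈P ; rest∉P = anti-mono s⊆t t∉P
              ; within = within ; meetsB = meetsB ; sublist = ⊆l ∘ ∷⁺ʳ x s⊆t }

  first∈Q : ∀ {Q l} → IsSeparation G P Q → B ⊆ Q → (c : Crossing G A B P l) → Crossing.first c ∈ Q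
  first∈Q {Q} sep B⊆Q c with Crossing.first c ∈? Q
  ... | yes x∈Q = x∈Q
  ... | no x∉Q  = ⊥-elim (stuck isWalk rest∉P meetsB)
    where
    open Crossing c
    stuck : ∀ {t} → IsWalk G (first ∷ t) → All (_∉ P) t → Any (_∈ B) (first ∷ t) → ⊥
    stuck [-]      []          (here x∈B) = x∉Q (B⊆Q x∈B)
    stuck (xy ∷ _) (y∉P ∷ _)   _          = y∉P (neighbour∈A sep xy first∈P x∉Q)

module _ {G : Graph} {X : VSet G} {w : ℕ} (D : PathDecomposition G X w) where
  open PathDecomposition D

  edge-in-bag : ∀ {u v} → Adjacent G u v → u ∈ X → v ∈ X → ∃ λ i → u ∈ bag i × v ∈ bag i
  edge-in-bag (e , inj₁ eq) u∈X v∈X with ends G e | edgeIn e | eq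
  ... | _ | inBag | refl = inBag u∈X v∈X
  edge-in-bag (e , inj₂ eq) u∈X v∈X with ends G e | edgeIn e | eq
  ... | _ | inBag | refl = let i , v∈i , u∈i = inBag v∈X u∈X in i , u∈i , v∈i

  InBagBefore InBagAfter : Fin (suc k) → V G → Set
  InBagBefore j v = ∃ λ i → i < j × v ∈ bag i
  InBagAfter  j v = ∃ λ l → j < l × v ∈ bag l

  -- Every edge lies in some bag; the first edge whose bag is not before j puts its first end into bag j.
  walk-meets-bag : ∀ {j xs} → IsWalk G xs → All (_∈ X) xs →
                   Any (InBagBefore j) xs → Any (InBagAfter j) xs → Any (_∈ bag j) xs
  walk-meets-bag {j} _ _ (here (i , i<j , v∈i)) (here (l , j<l , v∈l)) =
    here (interp i j l i<j j<l (x∈p∩q⁺ (v∈i , v∈l)))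
  walk-meets-bag (_ ∷ walk) (_ ∷ inX) (there before) (there after) =
    there (walk-meets-bag walk inX before after)
  walk-meets-bag {j} (xy ∷ walk) (x∈X ∷ inX@(y∈X ∷ _)) (here (i , i<j , x∈i)) (there after)
    with edge-in-bag xy x∈X y∈X
  ... | m , x∈m , y∈m with <-cmp m j
  ...   | tri< m<j _ _  = there (walk-meets-bag walk inX (here (m , m<j , y∈m)) after)
  ...   | tri≈ _ refl _ = here x∈m
  ...   | tri> _ _ j<m  = here (interp i j m i<j j<m (x∈p∩q⁺ (x∈i , x∈m)))
  walk-meets-bag {j} (xy ∷ walk) (x∈X ∷ inX@(y∈X ∷ _)) (there before) (here (l , j<l , x∈l))
    with edge-in-bag xy x∈X y∈X
  ... | m , x∈m , y∈m with <-cmp m j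
  ...   | tri< m<j _ _  = here (interp m j l m<j j<l (x∈p∩q⁺ (x∈m , x∈l)))
  ...   | tri≈ _ refl _ = here x∈m
  ...   | tri> _ _ j<m  = there (walk-meets-bag walk inX before (here (m , j<m , y∈m)))

module Contraction {G : Graph} {X Y : VSet G} {w : ℕ} (D : PathDecomposition G X w) (Y⊆X : Y ⊆ X)
  {N : ℕ} (root : Fin N → V G) (rest : Fin N → List (V G))
  (isWalk : ∀ m → IsWalk G (root m ∷ rest m))
  (within : ∀ m → All (_∈ X) (root m ∷ rest m))
  (root∈Y : ∀ m → root m ∈ Y)
  (rest∉Y : ∀ m → All (_∉ Y) (rest m))
  (disjoint : ∀ {m m′ u} → u ∈ₗ root m ∷ rest m → u ∈ₗ root m′ ∷ rest m′ → m ≡ m′)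
  where
  open PathDecomposition D

  walk : Fin N → List (V G)
  walk m = root m ∷ rest m

  root-injective : Injective _≡_ _≡_ root
  root-injective eq = disjoint (here refl) (here eq)

  walk∩Y : ∀ {m u} → u ∈ₗ walk m → u ∈ Y → u ≡ root m
  walk∩Y     (here u≡root)  _   = u≡root
  walk∩Y {m} (there u∈rest) u∈Y = ⊥-elim (All.lookup (rest∉Y m) u∈rest u∈Y)

  InContractedBag : Fin (suc k) → V G → Set
  InContractedBag j v = (v ∈ bag j × v ∈ Y) ⊎ (∃ λ m → root m ≡ v × Any (_∈ bag j) (walk m))

  InContractedBag? : ∀ j → Decidable (InContractedBag j)
  InContractedBag? j v =
    (v ∈? bag j ×-dec v ∈? Y) ⊎-dec any? (λ m → root m ≟ v ×-dec Any.any? (_∈? bag j) (walk m))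

  contractedBag : Fin (suc k) → VSet G
  contractedBag j = subsetOf (InContractedBag? j)

  module _ {j : Fin (suc k)} {v : V G} where

    ∈-contractedBag⁺ : InContractedBag j v → v ∈ contractedBag j
    ∈-contractedBag⁺ = ∈-subsetOf⁺ (InContractedBag? j)

    ∈-contractedBag⁻ : v ∈ contractedBag j → InContractedBag j v
    ∈-contractedBag⁻ = ∈-subsetOf⁻ (InContractedBag? j)

  representative : ∀ {j v} → InContractedBag j v → V G
  representative {v = v} (inj₁ _)               = v
  representative         (inj₂ (_ , _ , meets)) = proj₁ (find meets)

  representative∈bag : ∀ {j v} (p : InContractedBag j v) → representative p ∈ bag j
  representative∈bag (inj₁ (v∈j , _))       = v∈j
  representative∈bag (inj₂ (_ , _ , meets)) = proj₂ (proj₂ (find meets))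

  representative-injective : ∀ {j v v′} (p : InContractedBag j v) (p′ : InContractedBag j v′) →
                             representative p ≡ representative p′ → v ≡ v′
  representative-injective (inj₁ _) (inj₁ _) eq = eq
  representative-injective (inj₁ (_ , v∈Y)) (inj₂ (m , refl , meets)) eq =
    let _ , u∈walk , _ = find meets in trans eq (walk∩Y u∈walk (subst (_∈ Y) eq v∈Y))
  representative-injective (inj₂ (m , refl , meets)) (inj₁ (_ , v′∈Y)) eq =
    let _ , u∈walk , _ = find meets in trans (sym (walk∩Y u∈walk (subst (_∈ Y) (sym eq) v′∈Y))) eq
  representative-injective (inj₂ (m , refl , meets)) (inj₂ (m′ , refl , meets′)) eq =
    let _ , u∈walk , _ = find meets ; _ , u′∈walk′ , _ = find meets′
    in cong root (disjoint u∈walk (subst (_∈ₗ walk m′) (sym eq) u′∈walk′))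

  contractedBag-width : ∀ j → ∣ contractedBag j ∣ ≤ suc w
  contractedBag-width j =
    ≤-trans (injection⇒≤∣p∣ (representative ∘ member) (representative∈bag ∘ member) injective) (width j)
    where
    member : ∀ i → InContractedBag j (select (contractedBag j) i)
    member i = ∈-contractedBag⁻ (select∈ _ i)
    injective : Injective _≡_ _≡_ (representative ∘ member)
    injective eq = select-injective _ (representative-injective (member _) (member _) eq)

  walk-through : ∀ {i j l} m → i < j → j < l →
                 Any (_∈ bag i) (walk m) → Any (_∈ bag l) (walk m) → InContractedBag j (root m)
  walk-through m i<j j<l meets-i meets-l =
    inj₂ (m , refl , walk-meets-bag D (isWalk m) (within m) (Any.map (λ u∈i → _ , i<j , u∈i) meets-i)
                                                          (Any.map (λ u∈l → _ , j<l , u∈l) meets-l))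

  contractedBag-interp : ∀ {i j l v} → i < j → j < l →
                         InContractedBag i v → InContractedBag l v → InContractedBag j v
  contractedBag-interp {i} {j} {l} i<j j<l (inj₁ (v∈i , v∈Y)) (inj₁ (v∈l , _)) =
    inj₁ (interp i j l i<j j<l (x∈p∩q⁺ (v∈i , v∈l)) , v∈Y)
  contractedBag-interp i<j j<l (inj₁ (v∈i , _)) (inj₂ (m , refl , meets-l)) =
    walk-through m i<j j<l (here v∈i) meets-l
  contractedBag-interp i<j j<l (inj₂ (m , refl , meets-i)) (inj₁ (v∈l , _)) =
    walk-through m i<j j<l meets-i (here v∈l)
  contractedBag-interp i<j j<l (inj₂ (m , refl , meets-i)) (inj₂ (m′ , root≡ , meets-l))
    with refl ← root-injective root≡ = walk-through m i<j j<l meets-i meets-l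

  contractedBag⊆Y : ∀ {j v} → InContractedBag j v → v ∈ Y
  contractedBag⊆Y (inj₁ (_ , v∈Y))      = v∈Y
  contractedBag⊆Y (inj₂ (m , refl , _)) = root∈Y m

  contracted : PathDecomposition G Y w
  contracted = record
    { k      = k
    ; bag    = contractedBag
    ; inX    = λ _ → contractedBag⊆Y ∘ ∈-contractedBag⁻
    ; cover  = λ v v∈Y → let i , v∈i = cover v (Y⊆X v∈Y) in i , ∈-contractedBag⁺ (inj₁ (v∈i , v∈Y))
    ; edgeIn = λ e u∈Y v∈Y → let i , u∈i , v∈i = edgeIn e (Y⊆X u∈Y) (Y⊆X v∈Y)
                             in i , ∈-contractedBag⁺ (inj₁ (u∈i , u∈Y)) , ∈-contractedBag⁺ (inj₁ (v∈i , v∈Y))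
    ; interp = λ i j l i<j j<l v∈ → let v∈i , v∈l = x∈p∩q⁻ _ _ v∈
                                    in ∈-contractedBag⁺ (contractedBag-interp i<j j<l (∈-contractedBag⁻ v∈i)
                                                                                      (∈-contractedBag⁻ v∈l))
    ; width  = contractedBag-width
    }

module Restriction {G : Graph} {w : ℕ} {A′ B′ P Q : VSet G}
  (A′B′ : IsSeparation G A′ B′) (PQ : IsSeparation G P Q) (P⊆A′ : P ⊆ A′) (B′⊆Q : B′ ⊆ Q)
  (paths : Fin (order G P Q) → Path G) (between : ∀ m → Between G P B′ (paths m)) (disjoint : Disjoint G paths)
  (D : PathDecomposition G A′ w) (lastBag≡ : PathDecomposition.lastBag D ≡ A′ ∩ B′)
  where
  open Crossing

  crossingOf : ∀ m → Crossing G A′ B′ P (vertices (paths m))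
  crossingOf m = let l , walk , meetsP , endsInB′ , l⊆ = walkAlong (paths m) (between m)
                     c = crossing A′B′ P⊆A′ walk meetsP endsInB′
                 in record { Crossing c hiding (sublist) ; sublist = l⊆ ∘ sublist c }

  root : Fin (order G P Q) → V G
  root = first ∘ crossingOf

  crossings-disjoint : ∀ {m m′ u} → u ∈ₗ root m ∷ rest (crossingOf m) → u ∈ₗ root m′ ∷ rest (crossingOf m′) →
                       m ≡ m′
  crossings-disjoint {m} {m′} u∈m u∈m′ with m ≟ m′
  ... | yes m≡m′ = m≡m′
  ... | no m≢m′  = let a , u≡a = ∈-tabulate⁻ {f = vtx (paths m)}  (sublist (crossingOf m)  u∈m)
                       b , u≡b = ∈-tabulate⁻ {f = vtx (paths m′)} (sublist (crossingOf m′) u∈m′)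
                   in ⊥-elim (disjoint m m′ m≢m′ a b (trans (sym u≡a) u≡b))

  root∈P∩Q : ∀ m → root m ∈ P ∩ Q
  root∈P∩Q m = x∈p∩q⁺ (first∈P (crossingOf m) , first∈Q PQ B′⊆Q (crossingOf m))

  open PathDecomposition D using (k; bag)
  open Contraction D P⊆A′ root (rest ∘ crossingOf) (isWalk ∘ crossingOf) (within ∘ crossingOf)
                   (first∈P ∘ crossingOf) (rest∉P ∘ crossingOf) crossings-disjoint public

  walk-meets-lastBag : ∀ m → Any (_∈ bag (fromℕ k)) (walk m)
  walk-meets-lastBag m =
    let u , u∈walk , u∈B′ = find (meetsB (crossingOf m))
    in lose u∈walk (subst (u ∈_) (sym lastBag≡) (x∈p∩q⁺ (All.lookup (within (crossingOf m)) u∈walk , u∈B′)))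

  contracted-lastBag : contractedBag (fromℕ k) ≡ P ∩ Q
  contracted-lastBag = ⊆-antisym ⊆P∩Q P∩Q⊆
    where
    ⊆P∩Q : contractedBag (fromℕ k) ⊆ P ∩ Q
    ⊆P∩Q v∈ with ∈-contractedBag⁻ v∈
    ... | inj₁ (v∈last , v∈P) = x∈p∩q⁺ (v∈P , B′⊆Q (proj₂ (x∈p∩q⁻ A′ B′ (subst (_ ∈_) lastBag≡ v∈last))))
    ... | inj₂ (m , refl , _) = root∈P∩Q m
    P∩Q⊆ : P ∩ Q ⊆ contractedBag (fromℕ k)
    P∩Q⊆ v∈ = let m , root≡v = injection⇒surjective root root∈P∩Q root-injective v∈
              in ∈-contractedBag⁺ (inj₂ (m , root≡v , walk-meets-lastBag m))

mainTheorem1 : (G : Graph) (w : ℕ) (A' B' P Q : VSet G) →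
    IsSeparation G A' B' → IsSeparation G P Q →
    Good G w A' B' → _,_≤Sep_,_ {G} P Q A' B' →
    (Σ (Fin (order G P Q) → Path G) λ ps →
      ((i : Fin (order G P Q)) → Between G P B' (ps i)) × Disjoint G ps) →
    Good G w P Q
mainTheorem1 G w A' B' P Q A'B' PQ (D , lastBag≡) (P⊆A' , B'⊆Q) (paths , between , disjoint) =
  contracted , contracted-lastBag
  where open Restriction A'B' PQ P⊆A' B'⊆Q paths between disjoint D lastBag≡
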